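{- If $(\mathcal G,z)$ is a flow-critical canvas, then every edge of multiplicity more than one is incident with $z$.
   Context: Graphs are finite, loopless, may have parallel edges. A $\mathbb{Z}_3$-boundary of $G$ is $\beta:V(G)\to\mathbb{Z}_3$ summing to $0$ over every component; $\mathcal G=(G,\beta)$ is a $\mathbb{Z}_3$-bordered graph. A nowhere-zero flow is an orientation with $\deg^+(v)-\deg^-(v)\equiv\beta(v)\pmod 3$ for every $v$. For a partition $\mathcal P$ of $V(G)$, $\mathcal G/\mathcal P$ identifies each part into one vertex, deletes loops and sums $\beta$ over parts; $\mathcal P$ is non-trivial if some part has $\ge2$ vertices. A canvas $(\mathcal G,z)$ is a $\mathbb{Z}_3$-bordered graph with tip $z$. A tip preflow is an orientation $\psi$ of the edges at $z$ with (in $\psi$) $\deg^+(z)-\deg^-(z)\equiv\beta(z)\pmod 3$; it extends if some nowhere-zero flow agrees with it at $z$. $\mathcal P$ is tip-respecting if $\{z\}$ is a part. The canvas is flow-critical if for every non-trivial tip-respecting $\mathcal P$ some tip preflow extends to a nowhere-zero flow in $\mathcal G/\mathcal P$ but not in $\mathcal G$. -}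

module Defs where

open import Data.Nat using (ℕ; zero; suc; _+_)
open import Data.Nat.DivMod using (_mod_)
open import Data.Fin using (Fin; toℕ) renaming (zero to fzero)
open import Data.Fin.Properties using () renaming (_≟_ to _≟F_)
open import Data.List using (List; []; _∷_; length; filter; allFin; lookup; map)
open import Data.Product using (Σ; ∃; ∃-syntax; _×_; _,_; proj₁; proj₂)
open import Data.Sum using (_⊎_)
open import Data.Bool using (Bool; true; false; if_then_else_)
open import Data.Integer as ℤ using (ℤ; +_; _-_)
open import Data.Integer.Divisibility using () renaming (_∣_ to _∣ℤ_)
open import Relation.Nullary using (¬_; Dec; yes; no)
open import Relation.Nullary.Decidable using (¬?)
open import Relation.Nullary using (does)
open import Data.Nat.ListAction using (sum)
open import Relation.Binary.PropositionalEquality using (_≡_; _≢_)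
open import Function using (_∘_; _⇔_)
open import Function.Definitions using (Surjective)

ℤ₃ : Set
ℤ₃ = Fin 3

_≡₃_ : ℤ → ℤ → Set
a ≡₃ b = (+ 3) ∣ℤ (a - b)

-- A finite loopless multigraph: vertices Fin n, edges Fin m, each edge has an
-- ordered pair of (distinct) ends (the order is only a reference direction).
record Graph : Set where
  field
    n    : ℕ
    m    : ℕ
    ends : Fin m → Fin n × Fin n
open Graph public

Loopless : Graph → Set
Loopless G = ∀ e → proj₁ (ends G e) ≢ proj₂ (ends G e)

Incident : (G : Graph) → Fin (n G) → Fin (m G) → Set
Incident G v e = (proj₁ (ends G e) ≡ v) ⊎ (proj₂ (ends G e) ≡ v)

data Connected (G : Graph) : Fin (n G) → Fin (n G) → Set where
  here : ∀ {u} → Connected G u u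
  step : ∀ {u w} (e : Fin (m G)) →
         ((proj₁ (ends G e) ≡ u × proj₂ (ends G e) ≡ w) ⊎
          (proj₂ (ends G e) ≡ u × proj₁ (ends G e) ≡ w)) →
         ∀ {v} → Connected G w v → Connected G u v

sumOver : ∀ {k} → (Fin k → Bool) → (Fin k → ℤ₃) → ℤ₃
sumOver {k} S β = sum (map (λ v → if S v then toℕ (β v) else 0) (allFin k)) mod 3

-- β is a ℤ₃-boundary: sums to 0 over (the vertex set of) every component.
-- The component of u is given by its characteristic function S.
IsBoundary : (G : Graph) → (Fin (n G) → ℤ₃) → Set
IsBoundary G β = ∀ (u : Fin (n G)) (S : Fin (n G) → Bool) →
  (∀ v → (S v ≡ true) ⇔ Connected G u v) → sumOver S β ≡ fzero

record Bordered : Set where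
  field
    graph    : Graph
    loopless : Loopless graph
    β        : Fin (n graph) → ℤ₃
    boundary : IsBoundary graph β
open Bordered public

Orientation : Graph → Set
Orientation G = Fin (m G) → Bool

tail : (G : Graph) → Orientation G → Fin (m G) → Fin (n G)
tail G o e = if o e then proj₁ (ends G e) else proj₂ (ends G e)

head : (G : Graph) → Orientation G → Fin (m G) → Fin (n G)
head G o e = if o e then proj₂ (ends G e) else proj₁ (ends G e)

outdeg : (G : Graph) → Orientation G → Fin (n G) → ℕ
outdeg G o v = length (filter (λ e → tail G o e ≟F v) (allFin (m G)))

indeg : (G : Graph) → Orientation G → Fin (n G) → ℕ
indeg G o v = length (filter (λ e → head G o e ≟F v) (allFin (m G)))

FlowAt : (G : Graph) → (Fin (n G) → ℤ₃) → Orientation G → Fin (n G) → Set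
FlowAt G β o v = ((+ outdeg G o v) - (+ indeg G o v)) ≡₃ (+ toℕ (β v))

NZFlow : (𝒢 : Bordered) → Orientation (graph 𝒢) → Set
NZFlow 𝒢 o = ∀ v → FlowAt (graph 𝒢) (β 𝒢) o v

-- Contraction of a partition.  A partition of V(G) into k parts is a
-- surjection p : Fin n → Fin k (part j = p⁻¹(j)).

keptEdges : (G : Graph) {k : ℕ} → (Fin (n G) → Fin k) → List (Fin (m G))
keptEdges G p = filter (λ e → ¬? (p (proj₁ (ends G e)) ≟F p (proj₂ (ends G e))))
                       (allFin (m G))

contractGraph : (G : Graph) {k : ℕ} → (Fin (n G) → Fin k) → Graph
contractGraph G {k} p = record
  { n = k
  ; m = length (keptEdges G p)
  ; ends = λ i → let e = lookup (keptEdges G p) i in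
                 p (proj₁ (ends G e)) , p (proj₂ (ends G e)) }

origEdge : (G : Graph) {k : ℕ} (p : Fin (n G) → Fin k) →
           Fin (m (contractGraph G p)) → Fin (m G)
origEdge G p i = lookup (keptEdges G p) i

contractβ : (G : Graph) {k : ℕ} (p : Fin (n G) → Fin k) →
            (Fin (n G) → ℤ₃) → Fin k → ℤ₃
contractβ G p β j = sumOver (λ v → does (p v ≟F j)) β

-- G/P is loopless by construction; its boundary property is part of the
-- data, so we carry G/P as a graph together with its boundary function.

NonTrivial : ∀ {n k} → (Fin n → Fin k) → Set
NonTrivial p = ∃[ u ] ∃[ v ] (u ≢ v × p u ≡ p v)

TipRespecting : ∀ {n k} → (Fin n → Fin k) → Fin n → Set
TipRespecting p z = ∀ v → p v ≡ p z → v ≡ z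

-- A tip preflow is an orientation of the edges incident with z; we
-- represent it as a function on all edges of G, only the values on edges
-- incident with z being relevant.
TipPreflow : (𝒢 : Bordered) → Fin (n (graph 𝒢)) → Orientation (graph 𝒢) → Set
TipPreflow 𝒢 z ψ = FlowAt (graph 𝒢) (β 𝒢) ψ z

Extends : (𝒢 : Bordered) → Fin (n (graph 𝒢)) → Orientation (graph 𝒢) → Set
Extends 𝒢 z ψ = ∃[ o ] (NZFlow 𝒢 o × (∀ e → Incident (graph 𝒢) z e → o e ≡ ψ e))

-- ψ extends to a nowhere-zero flow of 𝒢/P (edges at the tip {z} of G/P
-- are identified with the edges at z of G via origEdge)
ExtendsContr : (𝒢 : Bordered) → Fin (n (graph 𝒢)) → {k : ℕ} →
               (Fin (n (graph 𝒢)) → Fin k) → Orientation (graph 𝒢) → Set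
ExtendsContr 𝒢 z p ψ =
  ∃[ o ] ((∀ j → FlowAt (contractGraph (graph 𝒢) p)
                        (contractβ (graph 𝒢) p (β 𝒢)) o j) ×
          (∀ i → Incident (graph 𝒢) z (origEdge (graph 𝒢) p i) →
                 o i ≡ ψ (origEdge (graph 𝒢) p i)))

FlowCritical : (𝒢 : Bordered) → Fin (n (graph 𝒢)) → Set
FlowCritical 𝒢 z = ∀ (k : ℕ) (p : Fin (n (graph 𝒢)) → Fin k) →
  Surjective _≡_ _≡_ p → NonTrivial p → TipRespecting p z →
  ∃[ ψ ] (TipPreflow 𝒢 z ψ × ExtendsContr 𝒢 z p ψ × ¬ Extends 𝒢 z ψ)

SameEnds : (G : Graph) → Fin (m G) → Fin (m G) → Set
SameEnds G e e' = (ends G e ≡ ends G e') ⊎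
  (proj₁ (ends G e) ≡ proj₂ (ends G e') × proj₂ (ends G e) ≡ proj₁ (ends G e'))

module Submission where

-- Suppose the distinct parallel edges e and e' join u and v, neither of which is z. Identifying
-- u with v is a non-trivial tip-respecting partition, so criticality gives a tip preflow ψ that
-- extends to a flow o of 𝒢/{u,v} but not of 𝒢. Lift o to an orientation of 𝒢 by keeping the
-- orientation of every edge that survives the contraction; e and e' became loops and are still
-- free. A vertex other than u and v is a part on its own, so its boundary condition is inherited
-- from 𝒢/{u,v}. Each of e, e' contributes ±1 to the net outflow at u, and ±1 ± 1 meets all three
-- residues mod 3, so they can be oriented to satisfy the condition at u; the condition at v is
-- then the one on the part {u, v} minus the one at u. So the lift is a flow of 𝒢 extending ψ.

open import Defs
import Data.Integer.Properties as ℤP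
open import Algebra.Properties.CommutativeMonoid.Sum ℤP.+-0-commutativeMonoid
  using (sum; sum-syntax; ∑-distrib-+; ∑-comm; sum-cong-≗; sum-replicate-zero; sum-remove)
open import Data.Bool using (Bool; true; false; if_then_else_)
open import Data.Bool.Properties using (if-float)
open import Data.Empty using (⊥-elim)
open import Data.Fin using (Fin; toℕ; punchOut; punchIn) renaming (zero to fzero; suc to fsuc)
open import Data.Fin.Properties
  using (toℕ-fromℕ<; punchOut-cong; punchOut-injective; punchOut-punchIn; punchIn-punchOut; punchInᵢ≢i)
  renaming (_≟_ to _≟F_)
open import Data.Integer using (ℤ; +_; -_; _+_; _-_; _*_; _◃_)
open import Data.Integer.DivMod using (_%ℕ_; _/ℕ_; a≡a%ℕn+[a/ℕn]*n; n%ℕd<d)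
import Data.Integer.Divisibility.Signed as Signed
open import Data.Integer.Solver using (module +-*-Solver)
open import Data.List using (List; []; _∷_; length; filter; allFin; lookup; map; tabulate)
open import Data.List.Membership.Propositional using (_∈_)
open import Data.List.Membership.Propositional.Properties using (∈-filter⁻; ∈-filter⁺; ∈-lookup; ∈-allFin)
open import Data.List.Relation.Unary.All as All using ()
open import Data.List.Relation.Unary.AllPairs using (_∷_)
open import Data.List.Relation.Unary.Any using (index)
open import Data.List.Relation.Unary.Any.Properties using (lookup-index)
open import Data.List.Relation.Unary.Unique.Propositional using (Unique)
open import Data.List.Relation.Unary.Unique.Propositional.Properties using (filter⁺; allFin⁺)
open import Data.Nat as ℕ using (ℕ; zero; suc; pred)
open import Data.Nat.DivMod using (_mod_)
open import Data.Nat.ListAction using () renaming (sum to sumℕ)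
open import Data.Product using (∃₂; ∃-syntax; _,_; proj₁; proj₂)
open import Data.Sign using (Sign)
open import Data.Sum using (_⊎_; inj₁; inj₂; [_,_])
open import Data.Vec.Functional using (updateAt)
open import Data.Vec.Functional.Properties using (updateAt-updates; updateAt-minimal)
open import Function using (_∘_; id)
open import Function.Definitions using (Surjective)
open import Relation.Binary.PropositionalEquality
  using (_≡_; _≢_; refl; sym; trans; cong; cong₂; subst; subst₂; module ≡-Reasoning)
open import Relation.Nullary using (¬_; yes; no; does)
open import Relation.Nullary.Decidable using (dec-true; dec-false; ¬?; _⊎-dec_; decidable-stable)
open import Relation.Unary using (Decidable)

open +-*-Solver

-- Congruence modulo 3

-- _≡₃_ unfolds to divisibility of a difference, which Agda cannot invert, so the lemmas
-- below take the integers they relate as explicit arguments.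

toℤ : ℤ₃ → ℤ
toℤ r = + toℕ r

≡₃⇒∣ : ∀ a b → a ≡₃ b → + 3 Signed.∣ (a - b)
≡₃⇒∣ _ _ = Signed.∣ᵤ⇒∣

∣⇒≡₃ : ∀ a b → + 3 Signed.∣ (a - b) → a ≡₃ b
∣⇒≡₃ _ _ = Signed.∣⇒∣ᵤ

≡₃-trans : ∀ a b c → a ≡₃ b → b ≡₃ c → a ≡₃ c
≡₃-trans a b c a≡b b≡c =
  ∣⇒≡₃ a c (subst (+ 3 Signed.∣_) (solve 3 (λ a b c → (a :- b) :+ (b :- c) := a :- c) refl a b c)
                   (Signed.∣m∣n⇒∣m+n (≡₃⇒∣ a b a≡b) (≡₃⇒∣ b c b≡c)))

≡₃-+-congˡ : ∀ a b c → b ≡₃ c → (a + b) ≡₃ (a + c)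
≡₃-+-congˡ a b c b≡c =
  ∣⇒≡₃ (a + b) (a + c) (subst (+ 3 Signed.∣_) (solve 3 (λ a b c → b :- c := (a :+ b) :- (a :+ c)) refl a b c)
                               (≡₃⇒∣ b c b≡c))

≡₃-+-cancelˡ : ∀ a b c d → a ≡₃ c → (a + b) ≡₃ (c + d) → b ≡₃ d
≡₃-+-cancelˡ a b c d a≡c ab≡cd =
  ∣⇒≡₃ b d (subst (+ 3 Signed.∣_)
                   (solve 4 (λ a b c d → (a :+ b) :- (c :+ d) :- (a :- c) := b :- d) refl a b c d)
                   (Signed.∣m∣n⇒∣m-n (≡₃⇒∣ (a + b) (c + d) ab≡cd) (≡₃⇒∣ a c a≡c)))

%ℕ3-≡₃ : ∀ t → (+ (t %ℕ 3)) ≡₃ t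
%ℕ3-≡₃ t = ∣⇒≡₃ r t (Signed.divides (- q) (begin
  r - t                    ≡⟨ cong (_-_ r) (a≡a%ℕn+[a/ℕn]*n t 3) ⟩
  r - (r + q * + 3)        ≡⟨ solve 2 (λ r q → r :- (r :+ q :* con (+ 3)) := (:- q) :* con (+ 3)) refl r q ⟩
  - q * + 3                ∎))
  where
  open ≡-Reasoning
  r q : ℤ
  r = + (t %ℕ 3)
  q = t /ℕ 3

mod3-≡₃ : ∀ s → toℤ (s mod 3) ≡₃ (+ s)
mod3-≡₃ s = subst (_≡₃ (+ s)) (cong +_ (sym (toℕ-fromℕ< _))) (%ℕ3-≡₃ (+ s))

-- ±1 ± 1 takes the values 2, 0 and -2, one in each residue class.
sum-of-two-units : ∀ t → ∃₂ λ (s s' : Sign) → ((s ◃ 1) + (s' ◃ 1)) ≡₃ t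
sum-of-two-units t with t %ℕ 3 | n%ℕd<d t 3 | %ℕ3-≡₃ t
... | 0 | _ | r≡t = Sign.+ , Sign.- , r≡t
... | 1 | _ | r≡t = Sign.- , Sign.- , ≡₃-trans (- + 2) (+ 1) t -2≡1 r≡t
  where
  -2≡1 : (- + 2) ≡₃ (+ 1)
  -2≡1 = ∣⇒≡₃ (- + 2) (+ 1) (Signed.divides (- + 1) refl)
... | 2 | _ | r≡t = Sign.+ , Sign.+ , r≡t
... | suc (suc (suc _)) | ℕ.s≤s (ℕ.s≤s (ℕ.s≤s ())) | _

-- Finite sums of integers

∑-neg : ∀ {k} (g : Fin k → ℤ) → ∑[ i < k ] (- g i) ≡ - ∑[ i < k ] g i
∑-neg {zero}  g = refl
∑-neg {suc k} g = trans (cong (λ t → - g fzero + t) (∑-neg (g ∘ fsuc))) (sym (ℤP.neg-distrib-+ (g fzero) _))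

∑-distrib-− : ∀ {k} (g h : Fin k → ℤ) → ∑[ i < k ] (g i - h i) ≡ ∑[ i < k ] g i - ∑[ i < k ] h i
∑-distrib-− g h = trans (∑-distrib-+ g (-_ ∘ h)) (cong (_+_ (sum g)) (∑-neg h))

∑-support₁ : ∀ {k} {g : Fin k → ℤ} a → (∀ x → x ≢ a → g x ≡ + 0) → sum g ≡ g a
∑-support₁ {suc k} {g} a g≡0 = begin
  sum g                        ≡⟨ sum-remove {i = a} g ⟩
  g a + sum (g ∘ punchIn a)    ≡⟨ cong (_+_ (g a)) (sum-cong-≗ (λ y → g≡0 (punchIn a y) (punchInᵢ≢i a y))) ⟩
  g a + ∑[ i < k ] (+ 0)       ≡⟨ cong (_+_ (g a)) (sum-replicate-zero k) ⟩
  g a + + 0                    ≡⟨ ℤP.+-identityʳ (g a) ⟩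
  g a                          ∎
  where open ≡-Reasoning

∑-support₂ : ∀ {k} {g : Fin k → ℤ} {a b} → a ≢ b → (∀ x → x ≢ a → x ≢ b → g x ≡ + 0) →
             sum g ≡ g a + g b
∑-support₂ {suc k} {g} {a} {b} a≢b g≡0 = begin
  sum g                                ≡⟨ sum-remove {i = a} g ⟩
  g a + sum (g ∘ punchIn a)            ≡⟨ cong (_+_ (g a)) (∑-support₁ (punchOut a≢b) vanishes) ⟩
  g a + g (punchIn a (punchOut a≢b))   ≡⟨ cong (λ x → g a + g x) (punchIn-punchOut a≢b) ⟩
  g a + g b                            ∎
  where
  open ≡-Reasoning
  vanishes : ∀ y → y ≢ punchOut a≢b → g (punchIn a y) ≡ + 0
  vanishes y y≢ = g≡0 (punchIn a y) (punchInᵢ≢i a y)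
    (λ eq → y≢ (trans (sym (punchOut-punchIn a)) (punchOut-cong a eq)))

∑-agree-off₂ : ∀ {k} {g h : Fin k → ℤ} {a b} → a ≢ b → (∀ x → x ≢ a → x ≢ b → g x ≡ h x) →
               sum g - sum h ≡ (g a - h a) + (g b - h b)
∑-agree-off₂ {g = g} {h} a≢b g≡h = trans (sym (∑-distrib-− g h)) (∑-support₂ a≢b difference≡0)
  where
  difference≡0 : ∀ x → x ≢ _ → x ≢ _ → g x - h x ≡ + 0
  difference≡0 x x≢a x≢b = trans (cong (_- h x) (g≡h x x≢a x≢b)) (ℤP.+-inverseʳ (h x))

∑-ones : ∀ k → ∑[ i < k ] (+ 1) ≡ + k
∑-ones zero    = refl
∑-ones (suc k) = cong (_+_ (+ 1)) (∑-ones k)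

∑-lookup-filter : ∀ {A : Set} {P : A → Set} (P? : Decidable P) {k} (h : Fin k → A) (g : A → ℤ) →
  ∑[ i < length (filter P? (tabulate h)) ] g (lookup (filter P? (tabulate h)) i)
    ≡ ∑[ x < k ] (if does (P? (h x)) then g (h x) else + 0)
∑-lookup-filter P? {zero}  h g = refl
∑-lookup-filter P? {suc k} h g with does (P? (h fzero))
... | true  = cong (_+_ (g (h fzero))) (∑-lookup-filter P? (h ∘ fsuc) g)
... | false = trans (∑-lookup-filter P? (h ∘ fsuc) g) (sym (ℤP.+-identityˡ _))

length-filter-tabulate : ∀ {A : Set} {P : A → Set} (P? : Decidable P) {k} (h : Fin k → A) →
  + length (filter P? (tabulate h)) ≡ ∑[ x < k ] (if does (P? (h x)) then + 1 else + 0)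
length-filter-tabulate P? h = trans (sym (∑-ones _)) (∑-lookup-filter P? h (λ _ → + 1))

sumℕ-map-tabulate : ∀ {A : Set} {k} (g : A → ℕ) (h : Fin k → A) →
  + sumℕ (map g (tabulate h)) ≡ ∑[ i < k ] (+ g (h i))
sumℕ-map-tabulate {k = zero}  g h = refl
sumℕ-map-tabulate {k = suc k} g h =
  trans (ℤP.pos-+ (g (h fzero)) _) (cong (_+_ (+ g (h fzero))) (sumℕ-map-tabulate g (h ∘ fsuc)))

-- Net outflow

δ : ∀ {k} → Fin k → Fin k → ℤ
δ x y = if does (x ≟F y) then + 1 else + 0

δ-≡ : ∀ {k} {x y : Fin k} → x ≡ y → δ x y ≡ + 1
δ-≡ {x = x} {y} x≡y = cong (if_then + 1 else + 0) (dec-true (x ≟F y) x≡y)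

δ-≢ : ∀ {k} {x y : Fin k} → x ≢ y → δ x y ≡ + 0
δ-≢ {x = x} {y} x≢y = cong (if_then + 1 else + 0) (dec-false (x ≟F y) x≢y)

δ-cancel : ∀ {k} {x y z : Fin k} → x ≡ y → δ x z - δ y z ≡ + 0
δ-cancel {x = x} {z = z} refl = ℤP.+-inverseʳ (δ x z)

flux : (G : Graph) → Fin (n G) → Bool → Fin (m G) → ℤ
flux G x c f = δ (tail G (λ _ → c) f) x - δ (head G (λ _ → c) f) x

net : (G : Graph) → Orientation G → Fin (n G) → ℤ
net G O x = ∑[ f < m G ] flux G x (O f) f

outdeg-indeg≡net : ∀ (G : Graph) O x → (+ outdeg G O x) - (+ indeg G O x) ≡ net G O x
outdeg-indeg≡net G O x =
  trans (cong₂ _-_ (length-filter-tabulate (λ f → tail G O f ≟F x) id)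
                   (length-filter-tabulate (λ f → head G O f ≟F x) id))
        (sym (∑-distrib-− (λ f → δ (tail G O f) x) (λ f → δ (head G O f) x)))

net⇒flowAt : ∀ (G : Graph) β O x → net G O x ≡₃ toℤ (β x) → FlowAt G β O x
net⇒flowAt G β O x = subst (_≡₃ toℤ (β x)) (sym (outdeg-indeg≡net G O x))

flowAt⇒net : ∀ (G : Graph) β O x → FlowAt G β O x → net G O x ≡₃ toℤ (β x)
flowAt⇒net G β O x = subst (_≡₃ toℤ (β x)) (outdeg-indeg≡net G O x)

flux-unit : ∀ {G : Graph} {u f} → Incident G u f → proj₁ (ends G f) ≢ proj₂ (ends G f) →
            ∀ s → ∃[ c ] flux G u c f ≡ s ◃ 1
flux-unit (inj₁ a≡u) a≢b Sign.+ = true  , cong₂ _-_ (δ-≡ a≡u) (δ-≢ (λ b≡u → a≢b (trans a≡u (sym b≡u))))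
flux-unit (inj₁ a≡u) a≢b Sign.- = false , cong₂ _-_ (δ-≢ (λ b≡u → a≢b (trans a≡u (sym b≡u)))) (δ-≡ a≡u)
flux-unit (inj₂ b≡u) a≢b Sign.+ = false , cong₂ _-_ (δ-≡ b≡u) (δ-≢ (λ a≡u → a≢b (trans a≡u (sym b≡u))))
flux-unit (inj₂ b≡u) a≢b Sign.- = true  , cong₂ _-_ (δ-≢ (λ a≡u → a≢b (trans a≡u (sym b≡u)))) (δ-≡ b≡u)

-- Contraction

partSum : ∀ {n k} → (Fin n → Fin k) → Fin k → (Fin n → ℤ) → ℤ
partSum {n} p j g = ∑[ x < n ] (if does (p x ≟F j) then g x else + 0)

module _ {n k} (p : Fin n → Fin k) (j : Fin k) where

  partSum-− : ∀ g h → partSum p j (λ x → g x - h x) ≡ partSum p j g - partSum p j h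
  partSum-− g h = trans (sum-cong-≗ if-−) (∑-distrib-− (restrict g) (restrict h))
    where
    restrict : (Fin n → ℤ) → Fin n → ℤ
    restrict g x = if does (p x ≟F j) then g x else + 0
    if-− : ∀ x → restrict (λ y → g y - h y) x ≡ restrict g x - restrict h x
    if-− x with does (p x ≟F j)
    ... | true  = refl
    ... | false = refl

  partSum-δ : ∀ y → partSum p j (δ y) ≡ δ (p y) j
  partSum-δ y =
    trans (∑-support₁ y vanishes) (cong (λ d → if does (p y ≟F j) then d else + 0) (δ-≡ {x = y} refl))
    where
    vanishes : ∀ x → x ≢ y → (if does (p x ≟F j) then δ y x else + 0) ≡ + 0
    vanishes x x≢y with does (p x ≟F j)
    ... | true  = δ-≢ (x≢y ∘ sym)
    ... | false = refl

  partSum-∑ : ∀ {l} (F : Fin n → Fin l → ℤ) →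
              partSum p j (λ x → ∑[ f < l ] F x f) ≡ ∑[ f < l ] partSum p j (λ x → F x f)
  partSum-∑ {l} F = trans (sum-cong-≗ if-∑) (∑-comm (λ x f → if does (p x ≟F j) then F x f else + 0))
    where
    if-∑ : ∀ x → (if does (p x ≟F j) then ∑[ f < l ] F x f else + 0)
                 ≡ ∑[ f < l ] (if does (p x ≟F j) then F x f else + 0)
    if-∑ x with does (p x ≟F j)
    ... | true  = refl
    ... | false = sym (sum-replicate-zero l)

Lifts : (G : Graph) {k : ℕ} (p : Fin (n G) → Fin k) → Orientation G → Orientation (contractGraph G p) → Set
Lifts G p O o = ∀ i → O (origEdge G p i) ≡ o i

Collapsed : (G : Graph) {k : ℕ} (p : Fin (n G) → Fin k) → Fin (m G) → Set
Collapsed G p f = p (proj₁ (ends G f)) ≡ p (proj₂ (ends G f))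

module _ (G : Graph) {k} (p : Fin (n G) → Fin k) where

  private
    keep? : Decidable (¬_ ∘ Collapsed G p)
    keep? f = ¬? (p (proj₁ (ends G f)) ≟F p (proj₂ (ends G f)))

  origEdge-not-collapsed : ∀ i → ¬ Collapsed G p (origEdge G p i)
  origEdge-not-collapsed i = proj₂ (∈-filter⁻ keep? {xs = allFin (m G)} (∈-lookup i))

  not-collapsed-origEdge : ∀ {f} → ¬ Collapsed G p f → ∃[ i ] origEdge G p i ≡ f
  not-collapsed-origEdge {f} kept = index f∈kept , sym (lookup-index f∈kept)
    where
    f∈kept : f ∈ keptEdges G p
    f∈kept = ∈-filter⁺ keep? (∈-allFin f) kept

  net-contract : ∀ {O o} → Lifts G p O o → ∀ j → net (contractGraph G p) o j ≡ partSum p j (net G O)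
  net-contract {O} {o} lifts j = begin
    net C o j
      ≡⟨ sum-cong-≗ flux-in-contraction ⟩
    ∑[ i < m C ] flux-at-part (origEdge G p i)
      ≡⟨ ∑-lookup-filter keep? id flux-at-part ⟩
    ∑[ f < m G ] (if does (keep? f) then flux-at-part f else + 0)
      ≡⟨ sum-cong-≗ loops-vanish ⟩
    ∑[ f < m G ] flux-at-part f
      ≡⟨ sum-cong-≗ (λ f → sym (partSum-flux f)) ⟩
    ∑[ f < m G ] partSum p j (λ x → flux G x (O f) f)
      ≡⟨ sym (partSum-∑ p j (λ x f → flux G x (O f) f)) ⟩
    partSum p j (net G O)
      ∎
    where
    open ≡-Reasoning
    C : Graph
    C = contractGraph G p

    flux-at-part : Fin (m G) → ℤ
    flux-at-part f = δ (p (tail G O f)) j - δ (p (head G O f)) j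

    flux-in-contraction : ∀ i → flux C j (o i) i ≡ flux-at-part (origEdge G p i)
    flux-in-contraction i = trans (cong (λ c → flux C j c i) (sym (lifts i)))
      (cong₂ (λ s t → δ s j - δ t j) (sym (if-float p (O f))) (sym (if-float p (O f))))
      where
      f : Fin (m G)
      f = origEdge G p i

    partSum-flux : ∀ f → partSum p j (λ x → flux G x (O f) f) ≡ flux-at-part f
    partSum-flux f = trans (partSum-− p j _ _) (cong₂ _-_ (partSum-δ p j _) (partSum-δ p j _))

    loops-vanish : ∀ f → (if does (keep? f) then flux-at-part f else + 0) ≡ flux-at-part f
    loops-vanish f with p (proj₁ (ends G f)) ≟F p (proj₂ (ends G f)) | O f
    ... | no _          | _     = refl
    ... | yes collapsed | true  = sym (δ-cancel collapsed)
    ... | yes collapsed | false = sym (δ-cancel (sym collapsed))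

  contractβ-≡₃ : ∀ (β : Fin (n G) → ℤ₃) j → toℤ (contractβ G p β j) ≡₃ partSum p j (toℤ ∘ β)
  contractβ-≡₃ β j =
    subst (toℤ (contractβ G p β j) ≡₃_) sum≡partSum (mod3-≡₃ (sumℕ (map β-in-part (allFin (n G)))))
    where
    β-in-part : Fin (n G) → ℕ
    β-in-part x = if does (p x ≟F j) then toℕ (β x) else 0
    sum≡partSum : + sumℕ (map β-in-part (allFin (n G))) ≡ partSum p j (toℤ ∘ β)
    sum≡partSum = trans (sumℕ-map-tabulate β-in-part id) (sum-cong-≗ (λ x → if-float +_ (does (p x ≟F j))))

  partSum-flow : ∀ (β : Fin (n G) → ℤ₃) {O o} → Lifts G p O o → ∀ {j} →
                 FlowAt (contractGraph G p) (contractβ G p β) o j →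
                 partSum p j (net G O) ≡₃ partSum p j (toℤ ∘ β)
  partSum-flow β {O} {o} lifts {j} flow =
    ≡₃-trans (partSum p j (net G O)) (toℤ (contractβ G p β j)) (partSum p j (toℤ ∘ β))
      (subst (_≡₃ toℤ (contractβ G p β j)) (net-contract {O} {o} lifts j)
             (flowAt⇒net (contractGraph G p) (contractβ G p β) o j flow))
      (contractβ-≡₃ β j)

-- Identifying two vertices

record Merges {n k} (p : Fin n → Fin k) (u v : Fin n) : Set where
  field
    identifies   : p u ≡ p v
    injective-at : ∀ {x y} → p x ≡ p y → y ≢ u → y ≢ v → x ≡ y
    part-of-u    : ∀ {x} → p x ≡ p u → x ≡ u ⊎ x ≡ v

module _ {n k} {p : Fin n → Fin k} where

  partSum-singleton : ∀ {y} → (∀ {x} → p x ≡ p y → x ≡ y) → ∀ g → partSum p (p y) g ≡ g y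
  partSum-singleton {y} singleton g =
    trans (∑-support₁ y vanishes) (cong (if_then g y else + 0) (dec-true (p y ≟F p y) refl))
    where
    vanishes : ∀ x → x ≢ y → (if does (p x ≟F p y) then g x else + 0) ≡ + 0
    vanishes x x≢y = cong (if_then g x else + 0) (dec-false (p x ≟F p y) (x≢y ∘ singleton))

  partSum-pair : ∀ {u v} → u ≢ v → Merges p u v → ∀ g → partSum p (p u) g ≡ g u + g v
  partSum-pair {u} {v} u≢v merges g =
    trans (∑-support₂ u≢v vanishes)
          (cong₂ _+_ (cong (if_then g u else + 0) (dec-true (p u ≟F p u) refl))
                     (cong (if_then g v else + 0) (dec-true (p v ≟F p u) (sym identifies))))
    where
    open Merges merges
    vanishes : ∀ x → x ≢ u → x ≢ v → (if does (p x ≟F p u) then g x else + 0) ≡ + 0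
    vanishes x x≢u x≢v = cong (if_then g x else + 0)
      (dec-false (p x ≟F p u) (λ px≡pu → [ x≢u , x≢v ] (part-of-u px≡pu)))

  merges-tip-respecting : ∀ {u v z} → Merges p u v → z ≢ u → z ≢ v → TipRespecting p z
  merges-tip-respecting merges z≢u z≢v y py≡pz = Merges.injective-at merges py≡pz z≢u z≢v

merge : ∀ {n} (u v : Fin n) → u ≢ v → Fin n → Fin (pred n)
merge {suc _} u v u≢v x with v ≟F x
... | yes _   = punchOut (u≢v ∘ sym)
... | no v≢x = punchOut v≢x

merge-identifies : ∀ {n} {u v : Fin n} (u≢v : u ≢ v) → merge u v u≢v u ≡ merge u v u≢v v
merge-identifies {suc _} {u} {v} u≢v with v ≟F u | v ≟F v
... | no _    | yes _  = punchOut-cong v refl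
... | yes v≡u | _      = ⊥-elim (u≢v (sym v≡u))
... | _       | no v≢v = ⊥-elim (v≢v refl)

merge-injective-at : ∀ {n} {u v : Fin n} (u≢v : u ≢ v) {x y} →
                     merge u v u≢v x ≡ merge u v u≢v y → y ≢ u → y ≢ v → x ≡ y
merge-injective-at {suc _} {u} {v} u≢v {x} {y} px≡py y≢u y≢v with v ≟F x | v ≟F y
... | _      | yes v≡y = ⊥-elim (y≢v (sym v≡y))
... | yes _  | no v≢y  = ⊥-elim (y≢u (sym (punchOut-injective (u≢v ∘ sym) v≢y px≡py)))
... | no v≢x | no v≢y  = punchOut-injective v≢x v≢y px≡py

merge-part-of-u : ∀ {n} {u v : Fin n} (u≢v : u ≢ v) {x} →
                  merge u v u≢v x ≡ merge u v u≢v u → x ≡ u ⊎ x ≡ v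
merge-part-of-u {suc _} {u} {v} u≢v {x} px≡pu with v ≟F x | v ≟F u
... | yes v≡x | _       = inj₂ (sym v≡x)
... | no _    | yes v≡u = ⊥-elim (u≢v (sym v≡u))
... | no v≢x  | no v≢u  = inj₁ (punchOut-injective v≢x v≢u px≡pu)

merge-merges : ∀ {n} {u v : Fin n} (u≢v : u ≢ v) → Merges (merge u v u≢v) u v
merge-merges u≢v = record
  { identifies   = merge-identifies u≢v
  ; injective-at = merge-injective-at u≢v
  ; part-of-u    = merge-part-of-u u≢v
  }

merge-surjective : ∀ {n} {u v : Fin n} (u≢v : u ≢ v) → Surjective _≡_ _≡_ (merge u v u≢v)
merge-surjective {suc _} {u} {v} u≢v y = punchIn v y , λ { refl → merge-punchIn }
  where
  merge-punchIn : merge u v u≢v (punchIn v y) ≡ y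
  merge-punchIn with v ≟F punchIn v y
  ... | yes v≡ = ⊥-elim (punchInᵢ≢i v y (sym v≡))
  ... | no _   = trans (punchOut-cong v refl) (punchOut-punchIn v)

-- Lifting orientations from a contraction

extend : ∀ {k} {A : Set} → A → (xs : List (Fin k)) → (Fin (length xs) → A) → Fin k → A
extend d []       g f = d
extend d (x ∷ xs) g f = if does (f ≟F x) then g fzero else extend d xs (g ∘ fsuc) f

extend-lookup : ∀ {k} {A : Set} (d : A) {xs : List (Fin k)} → Unique xs →
                ∀ g i → extend d xs g (lookup xs i) ≡ g i
extend-lookup d {x ∷ xs} (_ ∷ _) g fzero =
  cong (if_then g fzero else extend d xs (g ∘ fsuc) x) (dec-true (x ≟F x) refl)
extend-lookup d {x ∷ xs} (x∉xs ∷ unique) g (fsuc i) =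
  trans (cong (if_then g fzero else extend d xs (g ∘ fsuc) (lookup xs i))
              (dec-false (lookup xs i ≟F x) (λ eq → All.lookup x∉xs (∈-lookup i) (sym eq))))
        (extend-lookup d unique (g ∘ fsuc) i)

module _ (G : Graph) {k} (p : Fin (n G) → Fin k) where

  lift : Orientation (contractGraph G p) → Orientation G
  lift = extend true (keptEdges G p)

  lift-lifts : ∀ o → Lifts G p (lift o) o
  lift-lifts = extend-lookup true (filter⁺ _ (allFin⁺ (m G)))

  lifts-updateAt : ∀ {O o f} → Lifts G p O o → Collapsed G p f → ∀ c → Lifts G p (updateAt O f (λ _ → c)) o
  lifts-updateAt {O} {o} {f} lifts collapsed c i =
    trans (updateAt-minimal (origEdge G p i) f O
            (λ i≡f → origEdge-not-collapsed G p i (subst (Collapsed G p) (sym i≡f) collapsed)))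
          (lifts i)

  tip-edge-not-collapsed : Loopless G → ∀ {z} → TipRespecting p z → ∀ {f} → Incident G z f → ¬ Collapsed G p f
  tip-edge-not-collapsed loopless tip-respecting {f} (inj₁ a≡z) collapsed =
    loopless f (trans a≡z (sym (tip-respecting _ (trans (sym collapsed) (cong p a≡z)))))
  tip-edge-not-collapsed loopless tip-respecting {f} (inj₂ b≡z) collapsed =
    loopless f (trans (tip-respecting _ (trans collapsed (cong p b≡z))) (sym b≡z))

  lift-agrees-at-tip : Loopless G → ∀ {z} → TipRespecting p z → ∀ {O o} {ψ : Orientation G} → Lifts G p O o →
                       (∀ i → Incident G z (origEdge G p i) → o i ≡ ψ (origEdge G p i)) →
                       ∀ f → Incident G z f → O f ≡ ψ f
  lift-agrees-at-tip loopless {z} tip-respecting lifts agrees f z∈f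
    with not-collapsed-origEdge G p (tip-edge-not-collapsed loopless {z} tip-respecting z∈f)
  ... | i , refl = trans (lifts i) (agrees i z∈f)

-- Flows through an identified pair

lift-is-flow : ∀ (𝒢 : Bordered) {k} {p : Fin (n (graph 𝒢)) → Fin k} {u v} → u ≢ v → Merges p u v →
               ∀ {O o} → Lifts (graph 𝒢) p O o →
               (∀ j → FlowAt (contractGraph (graph 𝒢) p) (contractβ (graph 𝒢) p (β 𝒢)) o j) →
               net (graph 𝒢) O u ≡₃ toℤ (β 𝒢 u) → NZFlow 𝒢 O
lift-is-flow 𝒢 {p = p} {u} {v} u≢v merges {O} {o} lifts flow balanced-u x =
  net⇒flowAt G B O x (balanced x)
  where
  open Merges merges
  G : Graph
  G = graph 𝒢
  B : Fin (n G) → ℤ₃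
  B = β 𝒢

  on-part : ∀ j → partSum p j (net G O) ≡₃ partSum p j (toℤ ∘ B)
  on-part j = partSum-flow G p B {O} {o} lifts (flow j)

  balanced-v : net G O v ≡₃ toℤ (B v)
  balanced-v = ≡₃-+-cancelˡ (net G O u) (net G O v) (toℤ (B u)) (toℤ (B v)) balanced-u
    (subst₂ _≡₃_ (partSum-pair u≢v merges (net G O)) (partSum-pair u≢v merges (toℤ ∘ B)) (on-part (p u)))

  balanced : ∀ x → net G O x ≡₃ toℤ (B x)
  balanced x with x ≟F u | x ≟F v
  ... | yes refl | _        = balanced-u
  ... | no _     | yes refl = balanced-v
  ... | no x≢u   | no x≢v   =
    subst₂ _≡₃_ (partSum-singleton singleton (net G O)) (partSum-singleton singleton (toℤ ∘ B))
                (on-part (p x))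
    where
    singleton : ∀ {y} → p y ≡ p x → y ≡ x
    singleton py≡px = injective-at py≡px x≢u x≢v

balance-with-two-edges : ∀ (G : Graph) → Loopless G → ∀ {u e e'} → e ≢ e' → Incident G u e → Incident G u e' →
  ∀ (O : Orientation G) t → ∃₂ λ c c' → net G (updateAt (updateAt O e (λ _ → c)) e' (λ _ → c')) u ≡₃ t
balance-with-two-edges G loopless {u} {e} {e'} e≢e' u∈e u∈e' O t =
  let (s , s' , s+s'≡t-D) = sum-of-two-units (t - D)
      (c , flux-c≡s)      = flux-unit {G} u∈e (loopless e) s
      (c' , flux-c'≡s')   = flux-unit {G} u∈e' (loopless e') s'
  in c , c' , balanced c c' (subst₂ (λ x y → (x + y) ≡₃ (t - D)) (sym flux-c≡s) (sym flux-c'≡s') s+s'≡t-D)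
  where
  O′ : Bool → Bool → Orientation G
  O′ c c' = updateAt (updateAt O e (λ _ → c)) e' (λ _ → c')

  D : ℤ
  D = net G O u - flux G u (O e) e - flux G u (O e') e'

  reoriented-net : ∀ c c' → net G (O′ c c') u ≡ D + (flux G u c e + flux G u c' e')
  reoriented-net c c' = begin
    X′
      ≡⟨ solve 2 (λ x′ x → x′ := (x′ :- x) :+ x) refl X′ X ⟩
    (X′ - X) + X
      ≡⟨ cong (_+ X) (∑-agree-off₂ e≢e' unchanged) ⟩
    ((flux G u (O′ c c' e) e - a) + (flux G u (O′ c c' e') e' - b)) + X
      ≡⟨ cong₂ (λ y y' → ((flux G u y e - a) + (flux G u y' e' - b)) + X) O′-e O′-e' ⟩
    ((flux G u c e - a) + (flux G u c' e' - b)) + X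
      ≡⟨ solve 5 (λ A B a b x → ((A :- a) :+ (B :- b)) :+ x := (x :- a :- b) :+ (A :+ B))
                 refl (flux G u c e) (flux G u c' e') a b X ⟩
    D + (flux G u c e + flux G u c' e')
      ∎
    where
    open ≡-Reasoning
    X′ X a b : ℤ
    X′ = net G (O′ c c') u
    X  = net G O u
    a  = flux G u (O e) e
    b  = flux G u (O e') e'

    O′-e : O′ c c' e ≡ c
    O′-e = trans (updateAt-minimal e e' (updateAt O e (λ _ → c)) e≢e') (updateAt-updates e O)

    O′-e' : O′ c c' e' ≡ c'
    O′-e' = updateAt-updates e' (updateAt O e (λ _ → c))

    unchanged : ∀ f → f ≢ e → f ≢ e' → flux G u (O′ c c' f) f ≡ flux G u (O f) f
    unchanged f f≢e f≢e' = cong (λ y → flux G u y f)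
      (trans (updateAt-minimal f e' (updateAt O e (λ _ → c)) f≢e') (updateAt-minimal f e O f≢e))

  balanced : ∀ c c' → (flux G u c e + flux G u c' e') ≡₃ (t - D) → net G (O′ c c') u ≡₃ t
  balanced c c' fluxes≡t-D =
    subst₂ _≡₃_ (sym (reoriented-net c c')) (solve 2 (λ d t → d :+ (t :- d) := t) refl D t)
      (≡₃-+-congˡ D (flux G u c e + flux G u c' e') (t - D) fluxes≡t-D)

-- Parallel edges

parallel-incident : ∀ {G : Graph} {e e' x} → SameEnds G e e' → Incident G x e → Incident G x e'
parallel-incident (inj₁ same)       (inj₁ a≡x) = inj₁ (trans (cong proj₁ (sym same)) a≡x)
parallel-incident (inj₁ same)       (inj₂ b≡x) = inj₂ (trans (cong proj₂ (sym same)) b≡x)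
parallel-incident (inj₂ (a≡b' , _)) (inj₁ a≡x) = inj₂ (trans (sym a≡b') a≡x)
parallel-incident (inj₂ (_ , b≡a')) (inj₂ b≡x) = inj₁ (trans (sym b≡a') b≡x)

parallel-collapsed : ∀ {G : Graph} {k} {p : Fin (n G) → Fin k} {e e'} →
                     SameEnds G e e' → Collapsed G p e → Collapsed G p e'
parallel-collapsed {p = p} (inj₁ same) collapsed =
  subst (λ ends → p (proj₁ ends) ≡ p (proj₂ ends)) same collapsed
parallel-collapsed {p = p} (inj₂ (a≡b' , b≡a')) collapsed =
  trans (cong p (sym b≡a')) (trans (sym collapsed) (cong p a≡b'))

parallel-pair-extends : ∀ (𝒢 : Bordered) z {k} {p : Fin (n (graph 𝒢)) → Fin k} {e e'} →
  e ≢ e' → SameEnds (graph 𝒢) e e' → ¬ Incident (graph 𝒢) z e →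
  Merges p (proj₁ (ends (graph 𝒢) e)) (proj₂ (ends (graph 𝒢) e)) →
  ∀ {ψ} → ExtendsContr 𝒢 z p ψ → Extends 𝒢 z ψ
parallel-pair-extends 𝒢 z {p = p} {e} {e'} e≢e' parallel z∉e merges (o , flow , agrees) =
  let (c , c' , balanced) = balance-with-two-edges G (loopless 𝒢) e≢e' (inj₁ refl)
                              (parallel-incident {G} parallel (inj₁ refl))
                              (lift G p o) (toℤ (β 𝒢 (proj₁ (ends G e))))
  in O c c' , lift-is-flow 𝒢 (loopless 𝒢 e) merges {O c c'} (lifts c c') flow balanced
            , lift-agrees-at-tip G p (loopless 𝒢) {z} tip-respecting (lifts c c') agrees
  where
  G : Graph
  G = graph 𝒢

  O : Bool → Bool → Orientation G
  O c c' = updateAt (updateAt (lift G p o) e (λ _ → c)) e' (λ _ → c')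

  lifts : ∀ c c' → Lifts G p (O c c') o
  lifts c c' = lifts-updateAt G p (lifts-updateAt G p (lift-lifts G p o) (Merges.identifies merges) c)
                              (parallel-collapsed {G} {p = p} parallel (Merges.identifies merges)) c'

  tip-respecting : TipRespecting p z
  tip-respecting = merges-tip-respecting merges (z∉e ∘ inj₁ ∘ sym) (z∉e ∘ inj₂ ∘ sym)

mainTheorem17 : (𝒢 : Bordered) (z : Fin (n (graph 𝒢))) → FlowCritical 𝒢 z →
    ∀ (e e' : Fin (m (graph 𝒢))) → e ≢ e' → SameEnds (graph 𝒢) e e' →
    Incident (graph 𝒢) z e
mainTheorem17 𝒢 z critical e e' e≢e' parallel = decidable-stable (u ≟F z ⊎-dec v ≟F z) ¬¬z∈e
  where
  u v : Fin (n (graph 𝒢))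
  u = proj₁ (ends (graph 𝒢) e)
  v = proj₂ (ends (graph 𝒢) e)

  u≢v : u ≢ v
  u≢v = loopless 𝒢 e

  ¬¬z∈e : ¬ ¬ Incident (graph 𝒢) z e
  ¬¬z∈e z∉e =
    let (_ , _ , extends-in-contraction , ¬extends) =
          critical _ (merge u v u≢v) (merge-surjective u≢v) (u , v , u≢v , merge-identifies u≢v)
                   (merges-tip-respecting (merge-merges u≢v) (z∉e ∘ inj₁ ∘ sym) (z∉e ∘ inj₂ ∘ sym))
    in ¬extends (parallel-pair-extends 𝒢 z e≢e' parallel z∉e (merge-merges u≢v) extends-in-contraction)
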